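{- Let $n\ge1$ be an integer not divisible by $3$ and let $\Pi$ be a $(3,n)$-Dyck path. If $x\in\lambda(\Pi)$ is a cell in the first column that does not satisfy $\frac{\operatorname{arm}(x)}{\operatorname{leg}(x)+1}<\frac{3}{n}<\frac{\operatorname{arm}(x)+1}{\operatorname{leg}(x)}$, then either $\operatorname{arm}(x)=1$ and $\operatorname{leg}(x)<\frac{n}{3}-1$, or $\operatorname{arm}(x)=0$ and $\operatorname{leg}(x)>\frac{n}{3}$.
   Context: A $(3,n)$-Dyck path is a lattice path from $(0,0)$ to $(3,n)$ using unit north and east steps that stays weakly above the line $y=\frac{n}{3}x$. The cell $(a,b)$ ($a\in\{1,2,3\}$ column from left, $b\in\{1,\dots,n\}$ row from bottom) is $[a-1,a]\times[b-1,b]$. $\lambda(\Pi)$ is the set of cells lying above (north-west of) $\Pi$. For $x\in\lambda(\Pi)$, $\operatorname{arm}(x)$ (resp. $\operatorname{leg}(x)$) is the number of cells of $\lambda(\Pi)$ strictly east (resp. strictly south) of $x$ in its row (resp. column); a fraction with denominator $0$ is read as $+\infty$. -}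

module Defs where

open import Data.Nat using (ℕ; zero; suc; _+_; _*_; _≤_; _<_; _≟_; _<?_; _≤?_)
open import Data.Product using (_×_; _,_)
open import Data.Unit using (⊤)
open import Data.List using (List; []; _∷_; length; filter; map)
open import Data.List.Relation.Unary.All using (All)
open import Data.List.Relation.Unary.Any using (Any; any?)
open import Relation.Nullary using (Dec; ¬_)
open import Relation.Nullary.Decidable using (_×-dec_)
open import Relation.Binary.PropositionalEquality using (_≡_)

data Step : Set where
  N E : Step

pointsFrom : ℕ × ℕ → List Step → List (ℕ × ℕ)
pointsFrom p [] = p ∷ []
pointsFrom (x , y) (N ∷ s) = (x , y) ∷ pointsFrom (x , suc y) s
pointsFrom (x , y) (E ∷ s) = (x , y) ∷ pointsFrom (suc x , y) s

points : List Step → List (ℕ × ℕ)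
points = pointsFrom (0 , 0)

endFrom : ℕ × ℕ → List Step → ℕ × ℕ
endFrom p [] = p
endFrom (x , y) (N ∷ s) = endFrom (x , suc y) s
endFrom (x , y) (E ∷ s) = endFrom (suc x , y) s

WeaklyAbove : ℕ → ℕ × ℕ → Set
WeaklyAbove n (x , y) = n * x ≤ 3 * y

IsDyck : ℕ → List Step → Set
IsDyck n π = (endFrom (0 , 0) π ≡ (3 , n)) × All (WeaklyAbove n) (points π)

-- the cell (a,b) = [a-1,a]×[b-1,b] lies above (north-west of) the path π:
-- it is a cell of the 3×n rectangle and the path reaches the vertical line
-- x = a at some height y ≤ b-1 (i.e. y < b), so the cell is to the left of /
-- above the path.
InLambda : ℕ → List Step → ℕ → ℕ → Set
InLambda n π a b =
  (1 ≤ a) × (a ≤ 3) × (1 ≤ b) × (b ≤ n) ×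
  Any (λ q → (Data.Product.proj₁ q ≡ a) × (Data.Product.proj₂ q < b)) (points π)

inLambda? : ∀ n π a b → Dec (InLambda n π a b)
inLambda? n π a b =
  (1 ≤? a) ×-dec (a ≤? 3) ×-dec (1 ≤? b) ×-dec (b ≤? n) ×-dec
  any? (λ q → (Data.Product.proj₁ q ≟ a) ×-dec (Data.Product.proj₂ q <? b)) (points π)

range : ℕ → ℕ → List ℕ
range lo zero = []
range lo (suc k) = lo ∷ range (suc lo) k

arm : ℕ → List Step → ℕ → ℕ → ℕ
arm n π a b = length (filter (λ a' → inLambda? n π a' b) (range (suc a) 3))

leg : ℕ → List Step → ℕ → ℕ → ℕ
leg n π a b = length (filter (λ b' → inLambda? n π a b' ×-dec (b' <? b)) (range 1 n))

-- arm/(leg+1) < 3/n < (arm+1)/leg, for n ≥ 1, with fractions cross-multiplied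
-- (all denominators positive) and (arm+1)/0 read as +∞.
HookIneq : ℕ → ℕ → ℕ → Set
HookIneq n ar lg = (ar * n < 3 * (lg + 1)) × RightPart lg
  where
  RightPart : ℕ → Set
  RightPart zero = ⊤
  RightPart (suc l) = 3 * suc l < n * (ar + 1)

-- A cell (a,b) of λ(Π) has n a < 3 b, because Π meets the line x = a at some
-- height y < b and n a ≤ 3 y there.  So (3,b) ∉ λ(Π) when b ≤ n, giving arm ≤ 1,
-- and the cells below a first-column cell have heights in (n/3, n), giving
-- 3 leg < 2 n.  Under these bounds the failure of the hook inequality is pure
-- arithmetic, where 3 ∤ n rules out the boundary cases n = 3 leg and n = 3 (leg + 1).
module Submission where

open import Defs
open import Data.Nat using (ℕ; zero; suc; _+_; _*_; _∸_; _≤_; _<_; _>_; z≤n; s≤s; z<s; _<?_)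
open import Data.Nat.Properties
open import Data.Nat.Divisibility using (_∣_; m∣m*n)
open import Data.Product using (_×_; _,_; proj₁; proj₂)
open import Data.Sum using (_⊎_; inj₁; inj₂)
open import Data.List using (List; []; _∷_; _++_; length; filter)
open import Data.List.Properties using (filter-++; filter-none; length-filter; ++-identityʳ)
open import Data.List.Relation.Unary.All using (All; []; _∷_; lookupAny)
open import Data.Empty using (⊥-elim)
open import Data.Unit using (tt)
open import Function using (_∘_)
open import Level using (Level)
open import Relation.Nullary using (¬_; yes; no)
open import Relation.Nullary.Decidable using (_×-dec_)
open import Relation.Unary using (Pred; Decidable; ∁)
open import Relation.Binary.PropositionalEquality using (_≡_; _≢_; refl; sym; cong; subst; ≢-sym)

m+n≤o∧o<3*n⇒3*m<2*o : ∀ {m n o} → m + n ≤ o → o < 3 * n → 3 * m < 2 * o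
m+n≤o∧o<3*n⇒3*m<2*o {m} {n} {o} m+n≤o o<3n = +-cancelʳ-< o (3 * m) (2 * o) (begin-strict
  3 * m + o        <⟨ +-monoʳ-< (3 * m) o<3n ⟩
  3 * m + 3 * n    ≡⟨ sym (*-distribˡ-+ 3 m n) ⟩
  3 * (m + n)      ≤⟨ *-monoʳ-≤ 3 m+n≤o ⟩
  3 * o            ≡⟨ +-comm o (2 * o) ⟩
  2 * o + o        ∎)
  where open ≤-Reasoning

module _ {ℓ : Level} {P : Pred ℕ ℓ} (P? : Decidable P) where

  length-filter-++-none : ∀ xs {ys} → All (∁ P) ys → length (filter P? (xs ++ ys)) ≤ length xs
  length-filter-++-none xs {ys} ¬Pys = begin
    length (filter P? (xs ++ ys))                ≡⟨ cong length (filter-++ P? xs ys) ⟩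
    length (filter P? xs ++ filter P? ys)        ≡⟨ cong (length ∘ (filter P? xs ++_)) (filter-none P? ¬Pys) ⟩
    length (filter P? xs ++ [])                  ≡⟨ cong length (++-identityʳ (filter P? xs)) ⟩
    length (filter P? xs)                        ≤⟨ length-filter P? xs ⟩
    length xs                                    ∎
    where open ≤-Reasoning

  length-filter-range≤ : ∀ {u} → (∀ {x} → P x → x < u) → ∀ lo k →
                         length (filter P? (range lo k)) ≤ u ∸ lo
  length-filter-range≤ below lo zero = z≤n
  length-filter-range≤ {u} below lo (suc k) with P? lo
  ... | yes Plo = subst (suc (length (filter P? (range (suc lo) k))) ≤_) (sym (+-∸-assoc 1 (below Plo)))
                    (s≤s (length-filter-range≤ below (suc lo) k))
  ... | no _    = ≤-trans (length-filter-range≤ below (suc lo) k) (∸-monoʳ-≤ u (n≤1+n lo))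

  -- Recurse to the first counted element lo: then n < 3 lo, and at most n ∸ lo elements are counted.
  3*length-filter-range<2* : ∀ {n} → 1 ≤ n → (∀ {x} → P x → n < 3 * x × x < n) → ∀ lo k →
                             3 * length (filter P? (range lo k)) < 2 * n
  3*length-filter-range<2* 1≤n bounds lo zero = *-monoʳ-< 2 1≤n
  3*length-filter-range<2* {n} 1≤n bounds lo (suc k) with P? lo
  ... | no _    = 3*length-filter-range<2* 1≤n bounds (suc lo) k
  ... | yes Plo = m+n≤o∧o<3*n⇒3*m<2*o {count} (m≤o∸n⇒m+n≤o count (<⇒≤ lo<n) count≤n∸lo) n<3lo
    where
    n<3lo : n < 3 * lo
    n<3lo = proj₁ (bounds Plo)
    lo<n : lo < n
    lo<n = proj₂ (bounds Plo)
    count : ℕ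
    count = suc (length (filter P? (range (suc lo) k)))
    count≤n∸lo : count ≤ n ∸ lo
    count≤n∸lo = subst (count ≤_) (sym (+-∸-assoc 1 lo<n))
                   (s≤s (length-filter-range≤ (proj₂ ∘ bounds) (suc lo) k))

m∤n⇒m*k≢n : ∀ {m n} k → ¬ m ∣ n → m * k ≢ n
m∤n⇒m*k≢n k m∤n m*k≡n = m∤n (subst (_ ∣_) m*k≡n (m∣m*n k))

inLambda⇒n*a<3*b : ∀ {n π a b} → IsDyck n π → InLambda n π a b → n * a < 3 * b
inLambda⇒n*a<3*b {n} {b = b} (_ , above) (_ , _ , _ , _ , reaches) with lookupAny above reaches
... | n*x≤3*y , x≡a , y<b =
  subst (λ x → n * x < 3 * b) x≡a (≤-<-trans n*x≤3*y (*-monoʳ-< 3 y<b))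

hookIneq-arm1 : ∀ {n} L → 1 * n < 3 * (L + 1) → 3 * L < 2 * n → HookIneq n 1 L
hookIneq-arm1     zero    left _     = left , tt
hookIneq-arm1 {n} (suc l) left 3L<2n = left , subst (3 * suc l <_) (*-comm 2 n) 3L<2n

¬hookIneq-arm0 : ∀ {n L} → ¬ 3 ∣ n → ¬ HookIneq n 0 L → n < 3 * L
¬hookIneq-arm0 {L = zero} _ ¬hook = ⊥-elim (¬hook (z<s , tt))
¬hookIneq-arm0 {n} {suc l} 3∤n ¬hook = ≤∧≢⇒< n≤3L (≢-sym (m∤n⇒m*k≢n (suc l) 3∤n))
  where
  n≤3L : n ≤ 3 * suc l
  n≤3L = ≮⇒≥ λ 3L<n → ¬hook (z<s , subst (3 * suc l <_) (sym (*-identityʳ n)) 3L<n)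

¬hookIneq-arm1 : ∀ {n L} → ¬ 3 ∣ n → 3 * L < 2 * n → ¬ HookIneq n 1 L → 3 * (L + 1) < n
¬hookIneq-arm1 {n} {L} 3∤n 3L<2n ¬hook = ≤∧≢⇒< 3[L+1]≤n (m∤n⇒m*k≢n (L + 1) 3∤n)
  where
  3[L+1]≤n : 3 * (L + 1) ≤ n
  3[L+1]≤n = subst (3 * (L + 1) ≤_) (+-identityʳ n)
               (≮⇒≥ λ left → ¬hook (hookIneq-arm1 L left 3L<2n))

¬hookIneq : ∀ {n ar L} → ¬ 3 ∣ n → ar ≤ 1 → 3 * L < 2 * n → ¬ HookIneq n ar L →
            ((ar ≡ 1) × (3 * (L + 1) < n)) ⊎ ((ar ≡ 0) × (3 * L > n))
¬hookIneq 3∤n z≤n       _     ¬hook = inj₂ (refl , ¬hookIneq-arm0 3∤n ¬hook)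
¬hookIneq 3∤n (s≤s z≤n) 3L<2n ¬hook = inj₁ (refl , ¬hookIneq-arm1 3∤n 3L<2n ¬hook)

mainTheorem5 : (n : ℕ) → 1 ≤ n → ¬ (3 ∣ n) →
    (π : List Step) → IsDyck n π →
    (b : ℕ) → InLambda n π 1 b →
    ¬ HookIneq n (arm n π 1 b) (leg n π 1 b) →
    ((arm n π 1 b ≡ 1) × (3 * (leg n π 1 b + 1) < n))
      ⊎ ((arm n π 1 b ≡ 0) × (3 * leg n π 1 b > n))
mainTheorem5 n 1≤n 3∤n π dyck b (_ , _ , _ , b≤n , _) ¬hook =
  ¬hookIneq 3∤n arm≤1 3*leg<2*n ¬hook
  where
  3∉λ : ¬ InLambda n π 3 b
  3∉λ cell = <⇒≱ (inLambda⇒n*a<3*b dyck cell) (subst (3 * b ≤_) (*-comm 3 n) (*-monoʳ-≤ 3 b≤n))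

  arm≤1 : arm n π 1 b ≤ 1
  arm≤1 = length-filter-++-none (λ a → inLambda? n π a b) (2 ∷ [])
            (3∉λ ∷ (λ { (_ , s≤s (s≤s (s≤s ())) , _) }) ∷ [])

  below-in-column1 : ∀ {x} → InLambda n π 1 x × x < b → n < 3 * x × x < n
  below-in-column1 {x} (cell , x<b) =
    subst (_< 3 * x) (*-identityʳ n) (inLambda⇒n*a<3*b dyck cell) , <-≤-trans x<b b≤n

  3*leg<2*n : 3 * leg n π 1 b < 2 * n
  3*leg<2*n = 3*length-filter-range<2* (λ x → inLambda? n π 1 x ×-dec (x <? b)) 1≤n below-in-column1 1 n
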